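{- Let $G$ be a GSOS language. Then for all $P,Q\in\mathbb{T}(\Sigma_G)$, if $P$ and $Q$ are rule-matching bisimilar in $G$ ($P\mathrel{\underline{\leftrightarrow}}^{RM}_G Q$), then $\mathbb{A}(G)\models P=Q$, i.e., $P\sigma\mathrel{\underline{\leftrightarrow}}_G Q\sigma$ for every closed $\Sigma_G$-substitution $\sigma$.
   Context: Let $\mathit{Var}$ be a countably infinite set of variables and $\mathsf{Act}$ a fixed nonempty finite set of actions. A signature $\Sigma$ is a set of operation symbols each with an arity; $\mathbb{T}(\Sigma)$ is the set of terms over $\Sigma$ and $\mathit{Var}$; closed terms have no variables. A GSOS rule over $\Sigma$ has the form $$\frac{\bigcup_{i=1}^{l}\{x_i \xrightarrow{a_{ij}} y_{ij} \mid 1\le j\le m_i\}\ \cup\ \bigcup_{i=1}^{l}\{x_i \not\xrightarrow{b_{ik}} \mid 1\le k\le n_i\}}{f(x_1,\dots,x_l)\xrightarrow{c} C[\vec x,\vec y]}$$ with all variables distinct, $a_{ij},b_{ik},c\in\mathsf{Act}$, $f$ of arity $l$, $C$ a term with variables among $\vec x,\vec y$. A GSOS language $G=(\Sigma_G,R_G)$ is a finite signature with a finite set of GSOS rules; its transition relation $\to_G$ on closed terms is defined by structural induction: $f(\vec p)\xrightarrow{c}_G q$ iff some rule with principal operation $f$ and action $c$ and some closed substitution $\sigma$ with $\sigma(x_i)=p_i$ satisfy all antecedents ($\sigma(x_i)\xrightarrow{a_{ij}}_G\sigma(y_{ij})$; $\sigma(x_i)$ has no $b_{ik}$-transition) and $q=C\sigma$.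 A symmetric relation $\sim$ on closed terms is a bisimulation if $p\sim q$ and $p\xrightarrow{a}_G p'$ imply $q\xrightarrow{a}_G q'$ with $p'\sim q'$ for some $q'$; $\mathrel{\underline{\leftrightarrow}}_G$ is the largest bisimulation. $\mathbb{A}(G)\models P=Q$ means $P\sigma\mathrel{\underline{\leftrightarrow}}_G Q\sigma$ for all closed substitutions $\sigma$. Ruloids: a ruloid for a term $D$ has the shape of a GSOS rule but with source $D$ (all variables distinct); sourcevars are the $x_i$, targetvars the $y_{ij}$; $\mathrm{ante}(\rho)$ is its set of antecedents. It is sound if every closed substitution satisfying its antecedents yields a transition of $\to_G$ when applied to its consequent; a set of ruloids is supporting for $D$ and $c$ if all its consequents are $D\xrightarrow{c}\cdot$ and every closed transition $D[\vec p]\xrightarrow{c}p$ arises by instantiating one of them with a closed substitution satisfying its antecedents. For each term $P$, $\mathrm{ruloids}(P)$ is a fixed finite set of ruloids, the union over $c\in\mathsf{Act}$ of finite sets that are sound and supporting for $P$ and $c$. A ruloid $\rho=\frac{H}{P\xrightarrow{a}P'}$ is valid for $P$ iff $\rho=\rho'\sigma$ for some $\rho'\in\mathrm{ruloids}(P)$ and injective $\sigma:\mathrm{targetvars}(\rho')\to\mathit{Var}\setminus\mathrm{sourcevars}(\rho)$. Initial transition formulae: $F::=\mathsf{True}\mid x\xrightarrow{a}\mid\neg F\mid F\wedge F$; a closed substitution $\sigma$ satisfies $x\xrightarrow{a}$ iff $\sigma(x)\xrightarrow{a}_G p$ for some $p$, connectives as usual; $\models_G F\Rightarrow F'$ iff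 every closed substitution satisfying $F$ satisfies $F'$. For a set $H$ of positive/negative transition formulae, $\mathrm{hyps}(H)$ is the conjunction of $x\xrightarrow{a}$ for each $x\xrightarrow{a}y\in H$ and $\neg(x\xrightarrow{b})$ for each $x\not\xrightarrow{b}\in H$; $\mathrm{hyps}(\rho)=\mathrm{hyps}(\mathrm{ante}(\rho))$ and for a finite set $J$ of ruloids $\mathrm{hyps}(J)=\bigvee_{\rho'\in J}\mathrm{hyps}(\mathrm{ante}(\rho'))$. A symmetric relation $\approx\subseteq\mathbb{T}(\Sigma_G)\times\mathbb{T}(\Sigma_G)$ is a rule-matching bisimulation if $P\approx Q$ implies: for each ruloid $\rho=\frac{H}{P\xrightarrow{a}P'}$ in $\mathrm{ruloids}(P)$ there is a finite set $J$ of valid ruloids for $Q$ such that (1) for every $\rho'=\frac{H'}{Q\xrightarrow{a'}Q'}\in J$: (a) $a'=a$; (b) $P'\approx Q'$; (c) $(\mathrm{targetvars}(\rho')\cup\mathrm{targetvars}(\rho))\cap(\mathrm{sourcevars}(\rho)\cup\mathrm{sourcevars}(\rho'))=\emptyset$; (d) if $y\in\mathrm{targetvars}(\rho)\cap\mathrm{targetvars}(\rho')$ then $x\xrightarrow{b}y\in H\cap H'$ for some $x\in\mathrm{sourcevars}(\rho)\cap\mathrm{sourcevars}(\rho')$ and action $b$; and (2) $\models_G\mathrm{hyps}(\rho)\Rightarrow\mathrm{hyps}(J)$. $P\mathrel{\underline{\leftrightarrow}}^{RM}_G Q$ iff some rule-matching bisimulation relates $P$ and $Q$. Standing assumption: $G$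 contains no junk rules (rules supporting no transition of $\to_G$), and the ruloid sets considered contain no junk ruloids. -}

module Defs where

open import Data.Nat using (ℕ)
open import Data.Fin using (Fin)
open import Data.Empty using (⊥)
open import Data.Unit using (⊤)
open import Data.Sum using (_⊎_; inj₁; inj₂)
open import Data.Product using (Σ; Σ-syntax; ∃; _×_; _,_)
open import Data.List using (List; []; _∷_; length; _++_; map; foldr)
import Data.List as L
open import Data.List.Membership.Propositional using (_∈_; _∉_)
open import Data.List.Relation.Unary.Any using (Any)
open import Data.List.Relation.Unary.All using (All)
open import Data.Vec using (Vec; []; _∷_; lookup)
open import Relation.Binary.PropositionalEquality using (_≡_)
open import Relation.Binary.Definitions using (Symmetric)
open import Relation.Nullary using (¬_)

-- Terms over a signature (operation symbols Op with arities ar) and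
-- variables from V.  Open terms: V = ℕ (the countably infinite set Var).
-- Closed terms: V = ⊥.

data Term (Op : Set) (ar : Op → ℕ) (V : Set) : Set where
  var : V → Term Op ar V
  op  : (f : Op) → Vec (Term Op ar V) (ar f) → Term Op ar V

module _ {Op : Set} {ar : Op → ℕ} where

  mutual
    subst : {V W : Set} → Term Op ar V → (V → Term Op ar W) → Term Op ar W
    subst (var x)   σ = σ x
    subst (op f ts) σ = op f (substVec ts σ)

    substVec : {V W : Set} {n : ℕ} → Vec (Term Op ar V) n → (V → Term Op ar W)
             → Vec (Term Op ar W) n
    substVec []       σ = []
    substVec (t ∷ ts) σ = subst t σ ∷ substVec ts σ

  mutual
    vars : {V : Set} → Term Op ar V → List V
    vars (var x)   = x ∷ []
    vars (op f ts) = varsVec ts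

    varsVec : {V : Set} {n : ℕ} → Vec (Term Op ar V) n → List V
    varsVec []       = []
    varsVec (t ∷ ts) = vars t ++ varsVec ts

-- GSOS rules, in nameless form.  A rule with principal operation f of
-- arity l has, for each argument position i, a list of positive
-- premises  x_i -a_ij-> y_ij  (j < m_i, given by the list of actions
-- a_ij) and a list of negative premises  x_i -b_ik-/->  (given by the
-- list of actions b_ik), an action c, and a target term C whose
-- variables are among the x_i (inj₁ i) and the y_ij (inj₂ (i , j)).
-- Distinctness of all variables is built into this representation.

record Rule (Act Op : Set) (ar : Op → ℕ) (f : Op) : Set where
  field
    posP   : Fin (ar f) → List Act
    negP   : Fin (ar f) → List Act
    action : Act
    target : Term Op ar (Fin (ar f) ⊎ Σ (Fin (ar f)) (λ i → Fin (length (posP i))))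

record GSOS (Act : Set) : Set₁ where
  field
    nOps  : ℕ
    arity : Fin nOps → ℕ
    rules : (f : Fin nOps) → List (Rule Act (Fin nOps) arity f)

module _ {Act : Set} (G : GSOS Act) where
  open GSOS G

  Tm : Set
  Tm = Term (Fin nOps) arity ℕ

  CTm : Set
  CTm = Term (Fin nOps) arity ⊥

  CSubst : Set
  CSubst = ℕ → CTm

  _[_] : Tm → CSubst → CTm
  t [ σ ] = subst t σ

  Fire : {f : Fin nOps} → Rule Act (Fin nOps) arity f → Vec CTm (arity f)
       → (Fin (arity f) → Act → CTm → Set) → Act → CTm → Set
  Fire {f} r ps R c q =
    Rule.action r ≡ c ×
    Σ[ tg ∈ ((i : Fin (arity f)) → Fin (length (Rule.posP r i)) → CTm) ]
      ( (∀ i j → R i (L.lookup (Rule.posP r i) j) (tg i j))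
      × (∀ i b → b ∈ Rule.negP r i → ¬ Σ CTm (R i b))
      × q ≡ subst (Rule.target r) (env tg) )
    where
      env : ((i : Fin (arity f)) → Fin (length (Rule.posP r i)) → CTm)
          → (Fin (arity f) ⊎ Σ (Fin (arity f)) (λ i → Fin (length (Rule.posP r i)))) → CTm
      env tg (inj₁ i)       = lookup ps i
      env tg (inj₂ (i , j)) = tg i j

  mutual
    Trans : CTm → Act → CTm → Set
    Trans (op f ps) c q = Any (λ r → Fire r ps (λ i → lookup (TransVec ps) i) c q) (rules f)

    TransVec : {n : ℕ} → Vec CTm n → Vec (Act → CTm → Set) n
    TransVec []       = []
    TransVec (p ∷ ps) = Trans p ∷ TransVec ps

  NoJunkRules : Set
  NoJunkRules = ∀ f r → r ∈ rules f →
    Σ[ ps ∈ Vec CTm (arity f) ] Σ[ q ∈ CTm ]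
      Fire r ps (λ i → lookup (TransVec ps) i) (Rule.action r) q

  IsBisimulation : (CTm → CTm → Set) → Set
  IsBisimulation R = Symmetric R ×
    (∀ p q → R p q → ∀ a p' → Trans p a p' → Σ[ q' ∈ CTm ] (Trans q a q' × R p' q'))

  Bisimilar : CTm → CTm → Set₁
  Bisimilar p q = Σ[ R ∈ (CTm → CTm → Set) ] (IsBisimulation R × R p q)

  ValidEq : Tm → Tm → Set₁
  ValidEq P Q = (σ : CSubst) → Bisimilar (P [ σ ]) (Q [ σ ])

  record Ruloid : Set where
    field
      source : Tm
      posA   : List (ℕ × Act × ℕ)     -- antecedents x -a-> y
      negA   : List (ℕ × Act)         -- antecedents x -b-/->
      action : Act
      target : Tm
  open Ruloid public

  sourcevars : Ruloid → List ℕ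
  sourcevars ρ = vars (source ρ)

  targetvars : Ruloid → List ℕ
  targetvars ρ = map (λ { (x , a , y) → y }) (posA ρ)

  WellFormedFor : Tm → Ruloid → Set
  WellFormedFor D ρ =
    source ρ ≡ D ×
    (∀ x a y → (x , a , y) ∈ posA ρ → x ∈ vars D) ×
    (∀ x b → (x , b) ∈ negA ρ → x ∈ vars D) ×
    (∀ x a y x' a' y' → (x , a , y) ∈ posA ρ → (x' , a' , y') ∈ posA ρ →
        y ≡ y' → (x , a , y) ≡ (x' , a' , y')) ×
    (∀ y → y ∈ targetvars ρ → y ∉ vars D) ×
    (∀ z → z ∈ vars (target ρ) → z ∈ vars D ⊎ z ∈ targetvars ρ)

  SatAnte : CSubst → Ruloid → Set
  SatAnte σ ρ =
    (∀ x a y → (x , a , y) ∈ posA ρ → Trans (σ x) a (σ y)) ×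
    (∀ x b → (x , b) ∈ negA ρ → ¬ Σ CTm (Trans (σ x) b))

  Sound : Ruloid → Set
  Sound ρ = ∀ σ → SatAnte σ ρ → Trans (source ρ [ σ ]) (action ρ) (target ρ [ σ ])

  NotJunk : Ruloid → Set
  NotJunk ρ = Σ CSubst (λ σ → SatAnte σ ρ)

  SupportingFor : Tm → Act → List Ruloid → Set
  SupportingFor D c S = ∀ σ p → Trans (D [ σ ]) c p →
    Any (λ ρ → action ρ ≡ c × Σ[ σ' ∈ CSubst ]
               (SatAnte σ' ρ × source ρ [ σ' ] ≡ D [ σ ] × target ρ [ σ' ] ≡ p)) S

  record RuloidSets : Set where
    field
      ruloids    : Tm → List Ruloid
      wf         : ∀ P ρ → ρ ∈ ruloids P → WellFormedFor P ρ
      sound      : ∀ P ρ → ρ ∈ ruloids P → Sound ρ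
      supporting : ∀ P c → SupportingFor P c (ruloids P)
      noJunk     : ∀ P ρ → ρ ∈ ruloids P → NotJunk ρ

  data Formula : Set where
    True  : Formula
    _⇀_   : ℕ → Act → Formula
    ¬F_   : Formula → Formula
    _∧F_  : Formula → Formula → Formula

  Sat : CSubst → Formula → Set
  Sat σ True      = ⊤
  Sat σ (x ⇀ a)   = Σ CTm (Trans (σ x) a)
  Sat σ (¬F F)    = ¬ Sat σ F
  Sat σ (F ∧F F') = Sat σ F × Sat σ F'

  hyps : Ruloid → Formula
  hyps ρ = foldr (λ { (x , a , y) F → (x ⇀ a) ∧F F }) 
                 (foldr (λ { (x , b) F → (¬F (x ⇀ b)) ∧F F }) True (negA ρ))
                 (posA ρ)

  EntailsDisj : Ruloid → List Ruloid → Set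
  EntailsDisj ρ J = ∀ σ → Sat σ (hyps ρ) → Any (λ ρ' → Sat σ (hyps ρ')) J

  module _ (RS : RuloidSets) where
    open RuloidSets RS

    -- ρ'σ : rename the target variables of ρ' by τ (τ is the identity on
    -- the source variables)
    renameTargets : (ℕ → ℕ) → Ruloid → Ruloid
    renameTargets τ ρ' = record
      { source = source ρ'
      ; posA   = map (λ { (x , a , y) → (x , a , τ y) }) (posA ρ')
      ; negA   = negA ρ'
      ; action = action ρ'
      ; target = subst (target ρ') (λ v → var (τ v)) }

    ValidFor : Tm → Ruloid → Set
    ValidFor Q ρ = Σ[ ρ' ∈ Ruloid ] Σ[ τ ∈ (ℕ → ℕ) ]
      ( ρ' ∈ ruloids Q
      × (∀ v → v ∈ vars Q → τ v ≡ v)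
      × (∀ y y' → y ∈ targetvars ρ' → y' ∈ targetvars ρ' → τ y ≡ τ y' → y ≡ y')
      × (∀ y → y ∈ targetvars ρ' → τ y ∉ sourcevars ρ)
      × ρ ≡ renameTargets τ ρ' )

    -- conditions (1)(a)-(d) for ρ ∈ ruloids(P) and ρ' ∈ J
    Matches : (Tm → Tm → Set) → Ruloid → Ruloid → Set
    Matches R ρ ρ' =
      action ρ' ≡ action ρ ×
      R (target ρ) (target ρ') ×
      (∀ v → (v ∈ targetvars ρ' ⊎ v ∈ targetvars ρ) →
             (v ∈ sourcevars ρ ⊎ v ∈ sourcevars ρ') → ⊥) ×
      (∀ y → y ∈ targetvars ρ → y ∈ targetvars ρ' →
         Σ[ x ∈ ℕ ] Σ[ b ∈ Act ]
           (x ∈ sourcevars ρ × x ∈ sourcevars ρ' ×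
            (x , b , y) ∈ posA ρ × (x , b , y) ∈ posA ρ'))

    IsRuleMatchingBisim : (Tm → Tm → Set) → Set
    IsRuleMatchingBisim R = Symmetric R ×
      (∀ P Q → R P Q → ∀ ρ → ρ ∈ ruloids P →
         Σ[ J ∈ List Ruloid ]
           (All (ValidFor Q) J × All (Matches R ρ) J × EntailsDisj ρ J))

    RMBisimilar : Tm → Tm → Set₁
    RMBisimilar P Q = Σ[ R ∈ (Tm → Tm → Set) ] (IsRuleMatchingBisim R × R P Q)

module Submission where

-- Soundness of rule-matching bisimilarity (Theorem 5.1): if R is a
-- rule-matching bisimulation, then the relation
--   S = { (P[σ] , Q[σ]) | R P Q, σ a closed substitution }
-- is a bisimulation on closed terms, so every pair in R is a valid equation.
--
-- Let P[σ] -a-> p'.  As ruloids(P) is supporting, some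
-- ρ ∈ ruloids(P) and σ' with σ' = σ on the variables of P derive it, so σ
-- satisfies hyps(ρ).  Rule matching yields a valid ruloid ρ' for Q whose
-- hypotheses σ satisfies.  We then build a substitution θ that is σ on the
-- variables of Q, σ' on the target variables of ρ, and on the remaining
-- target variables of ρ' picks transitions witnessing hyps(ρ').  Conditions
-- (c) and (d) of rule matching make θ satisfy the antecedents of ρ', and
-- valid ruloids are sound, so Q[σ] -a-> target(ρ')[θ], which is S-related to
-- target(ρ)[θ] = p' by condition (b).
--
-- The no-junk assumption is not
-- needed.

open import Defs
open import Data.Nat using (ℕ; suc)
open import Data.Nat.Properties using (_≟_)
open import Data.Fin using (Fin)
open import Data.Empty using (⊥; ⊥-elim)
open import Data.Unit using (tt)
open import Data.Sum using (_⊎_; inj₁; inj₂)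
open import Data.Product using (Σ; Σ-syntax; _×_; _,_; proj₁; proj₂)
open import Data.List using (List; []; _∷_)
open import Data.List.Membership.Propositional using (_∈_; _∉_; find)
open import Data.List.Membership.Propositional.Properties
  using (∈-map⁺; ∈-map⁻; ∈-++⁺ˡ; ∈-++⁺ʳ; ∈-++⁻)
open import Data.List.Membership.DecPropositional _≟_ using (_∈?_)
open import Data.List.Relation.Unary.Any using (here; there)
open import Data.List.Relation.Unary.All using () renaming (lookup to All-lookup)
open import Data.Vec using (Vec; []; _∷_)
open import Data.Vec.Properties using (∷-injectiveˡ; ∷-injectiveʳ)
open import Function using (_∘_)
open import Relation.Binary.PropositionalEquality using (_≡_; refl; sym; trans; cong; cong₂)
import Relation.Binary.PropositionalEquality as ≡
open import Relation.Nullary using (¬_; Dec; yes; no)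

module _ {Op : Set} {ar : Op → ℕ} where

  mutual
    subst-cong : ∀ {V W : Set} (t : Term Op ar V) (f g : V → Term Op ar W) →
      (∀ v → v ∈ vars t → f v ≡ g v) → subst t f ≡ subst t g
    subst-cong (var x)   f g agree = agree x (here refl)
    subst-cong (op o ts) f g agree = cong (op o) (substVec-cong ts f g agree)

    substVec-cong : ∀ {V W : Set} {n} (ts : Vec (Term Op ar V) n) (f g : V → Term Op ar W) →
      (∀ v → v ∈ varsVec ts → f v ≡ g v) → substVec ts f ≡ substVec ts g
    substVec-cong []       f g agree = refl
    substVec-cong (t ∷ ts) f g agree =
      cong₂ _∷_ (subst-cong t f g (λ v m → agree v (∈-++⁺ˡ m)))
                (substVec-cong ts f g (λ v m → agree v (∈-++⁺ʳ (vars t) m)))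

  op-injective : ∀ {W : Set} {o} {ts us : Vec (Term Op ar W) (ar o)} → op o ts ≡ op o us → ts ≡ us
  op-injective refl = refl

  mutual
    subst-agree : ∀ {V W : Set} (t : Term Op ar V) (f g : V → Term Op ar W) →
      subst t f ≡ subst t g → ∀ v → v ∈ vars t → f v ≡ g v
    subst-agree (var x)   f g e v (here refl) = e
    subst-agree (op o ts) f g e v m = substVec-agree ts f g (op-injective e) v m

    substVec-agree : ∀ {V W : Set} {n} (ts : Vec (Term Op ar V) n) (f g : V → Term Op ar W) →
      substVec ts f ≡ substVec ts g → ∀ v → v ∈ varsVec ts → f v ≡ g v
    substVec-agree (t ∷ ts) f g e v m with ∈-++⁻ (vars t) m
    ... | inj₁ m₁ = subst-agree t f g (∷-injectiveˡ e) v m₁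
    ... | inj₂ m₂ = substVec-agree ts f g (∷-injectiveʳ e) v m₂

  mutual
    subst-comp : ∀ {U V W : Set} (t : Term Op ar U) (g : U → Term Op ar V) (h : V → Term Op ar W) →
      subst (subst t g) h ≡ subst t (λ v → subst (g v) h)
    subst-comp (var x)   g h = refl
    subst-comp (op o ts) g h = cong (op o) (substVec-comp ts g h)

    substVec-comp : ∀ {U V W : Set} {n} (ts : Vec (Term Op ar U) n)
      (g : U → Term Op ar V) (h : V → Term Op ar W) →
      substVec (substVec ts g) h ≡ substVec ts (λ v → subst (g v) h)
    substVec-comp []       g h = refl
    substVec-comp (t ∷ ts) g h = cong₂ _∷_ (subst-comp t g h) (substVec-comp ts g h)

override : {C : Set} → List ℕ → (ℕ → C) → (ℕ → C) → ℕ → C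
override xs f g v with v ∈? xs
... | yes _ = f v
... | no  _ = g v

override-in : {C : Set} (xs : List ℕ) (f g : ℕ → C) {v : ℕ} → v ∈ xs → override xs f g v ≡ f v
override-in xs f g {v} v∈ with v ∈? xs
... | yes _  = refl
... | no  v∉ = ⊥-elim (v∉ v∈)

override-out : {C : Set} (xs : List ℕ) (f g : ℕ → C) {v : ℕ} → v ∉ xs → override xs f g v ≡ g v
override-out xs f g {v} v∉ with v ∈? xs
... | yes v∈ = ⊥-elim (v∉ v∈)
... | no  _  = refl

UniqueTargets : {A : Set} → List (ℕ × A × ℕ) → Set
UniqueTargets L = ∀ x a y x' a' y' → (x , a , y) ∈ L → (x' , a' , y') ∈ L →
  y ≡ y' → (x , a , y) ≡ (x' , a' , y')

module ChooseTargets {A C : Set} (Witness : ℕ → A → C → Set) where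

  Witnesses : List (ℕ × A × ℕ) → Set
  Witnesses L = ∀ x a y → (x , a , y) ∈ L → Σ C (Witness x a)

  choose : (L : List (ℕ × A × ℕ)) → Witnesses L → (ℕ → C) → ℕ → C
  choose []                w g v = g v
  choose ((x , a , y) ∷ L) w g v with y ≟ v
  ... | yes _ = proj₁ (w x a y (here refl))
  ... | no  _ = choose L (λ x' a' y' m → w x' a' y' (there m)) g v

  choose-absent : ∀ L w g {v} → (∀ x a → (x , a , v) ∉ L) → choose L w g v ≡ g v
  choose-absent []                w g absent = refl
  choose-absent ((x , a , y) ∷ L) w g {v} absent with y ≟ v
  ... | yes refl = ⊥-elim (absent x a (here refl))
  ... | no  _    = choose-absent L _ g (λ x' a' m → absent x' a' (there m))

  choose-witness : ∀ L w g → UniqueTargets L → ∀ x a y → (x , a , y) ∈ L →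
    Witness x a (choose L w g y)
  choose-witness ((x₀ , a₀ , y₀) ∷ L) w g uniq x a y m with y₀ ≟ y
  ... | yes y₀≡y with uniq x₀ a₀ y₀ x a y (here refl) m y₀≡y
  ...   | refl = proj₂ (w x₀ a₀ y₀ (here refl))
  choose-witness ((x₀ , a₀ , y₀) ∷ L) w g uniq x a y (here refl) | no y₀≢y = ⊥-elim (y₀≢y refl)
  choose-witness ((x₀ , a₀ , y₀) ∷ L) w g uniq x a y (there m)   | no _ =
    choose-witness L _ g (λ x a y x' a' y' m m' → uniq x a y x' a' y' (there m) (there m')) x a y m

module Soundness {Act : Set} (G : GSOS Act) where

  Enabled : CSubst G → Ruloid G → Set
  Enabled σ ρ =
    (∀ x a y → (x , a , y) ∈ posA ρ → Σ (CTm G) (Trans G (σ x) a)) ×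
    (∀ x b → (x , b) ∈ negA ρ → ¬ Σ (CTm G) (Trans G (σ x) b))

  -- hyps(ρ) is defined by recursion over the antecedents, so both directions
  -- recurse over the antecedent lists of ρ.
  withAntecedents : Ruloid G → List (ℕ × Act × ℕ) → List (ℕ × Act) → Ruloid G
  withAntecedents ρ L N = record ρ { posA = L ; negA = N }

  enabled⇒sat : ∀ σ ρ → Enabled σ ρ → Sat G σ (hyps G ρ)
  enabled⇒sat σ ρ = go (posA ρ) (negA ρ)
    where
    go : ∀ L N → Enabled σ (withAntecedents ρ L N) → Sat G σ (hyps G (withAntecedents ρ L N))
    go [] [] _ = tt
    go [] ((x , b) ∷ N) (pos , neg) =
      neg x b (here refl) , go [] N (pos , λ x' b' m → neg x' b' (there m))
    go ((x , a , y) ∷ L) N (pos , neg) =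
      pos x a y (here refl) , go L N ((λ x' a' y' m → pos x' a' y' (there m)) , neg)

  sat⇒enabled : ∀ σ ρ → Sat G σ (hyps G ρ) → Enabled σ ρ
  sat⇒enabled σ ρ = go (posA ρ) (negA ρ)
    where
    go : ∀ L N → Sat G σ (hyps G (withAntecedents ρ L N)) → Enabled σ (withAntecedents ρ L N)
    go [] [] _ = (λ _ _ _ ()) , (λ _ _ ())
    go [] ((x , b) ∷ N) (s , ss) with go [] N ss
    ... | pos , neg = pos , λ { x' b' (here refl) → s ; x' b' (there m) → neg x' b' m }
    go ((x , a , y) ∷ L) N (s , ss) with go L N ss
    ... | pos , neg = (λ { x' a' y' (here refl) → s ; x' a' y' (there m) → pos x' a' y' m }) , neg

  sat⇒hyps : ∀ {D} {σ σ' : CSubst G} (ρ : Ruloid G) → WellFormedFor G D ρ →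
    (∀ v → v ∈ vars D → σ' v ≡ σ v) → SatAnte G σ' ρ → Sat G σ (hyps G ρ)
  sat⇒hyps {σ = σ} ρ (_ , posD , negD , _) agree (pos , neg) = enabled⇒sat σ ρ
    ( (λ x a y m → ≡.subst (λ p → Σ (CTm G) (Trans G p a)) (agree x (posD x a y m)) (_ , pos x a y m))
    , (λ x b m → ≡.subst (λ p → ¬ Σ (CTm G) (Trans G p b)) (agree x (negD x b m)) (neg x b m)) )

  target∈targetvars : ∀ {x a y} (ρ : Ruloid G) → (x , a , y) ∈ posA ρ → y ∈ targetvars G ρ
  target∈targetvars ρ m = ∈-map⁺ _ m

  ∈-sourcevars : ∀ {D v} (ρ : Ruloid G) → source ρ ≡ D → v ∈ vars D → v ∈ sourcevars G ρ
  ∈-sourcevars ρ refl m = m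

  agreeOnSource : ∀ {D} {σ σ' : CSubst G} (ρ : Ruloid G) → source ρ ≡ D →
    subst (source ρ) σ' ≡ subst D σ → ∀ v → v ∈ vars D → σ' v ≡ σ v
  agreeOnSource {D} {σ} {σ'} ρ refl e = subst-agree D σ' σ e

  module ValidRuloids (RS : RuloidSets G) where
    open RuloidSets RS

    -- A valid ruloid for Q has source Q, its antecedents concern variables of
    -- Q, its targets are unique, and it is sound: renaming the target
    -- variables injectively preserves all of these.
    valid-source : ∀ {Q ρ} → ValidFor G RS Q ρ → source ρ ≡ Q
    valid-source {Q} (ρ₀ , _ , ρ₀∈ , _ , _ , _ , refl) = proj₁ (wf Q ρ₀ ρ₀∈)

    valid-posSource : ∀ {Q ρ x a y} → ValidFor G RS Q ρ → (x , a , y) ∈ posA ρ → x ∈ vars Q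
    valid-posSource {Q} (ρ₀ , _ , ρ₀∈ , _ , _ , _ , refl) m with ∈-map⁻ _ m
    ... | (x , a , y) , m₀ , refl = proj₁ (proj₂ (wf Q ρ₀ ρ₀∈)) x a y m₀

    valid-negSource : ∀ {Q ρ x b} → ValidFor G RS Q ρ → (x , b) ∈ negA ρ → x ∈ vars Q
    valid-negSource {Q} (ρ₀ , _ , ρ₀∈ , _ , _ , _ , refl) m =
      proj₁ (proj₂ (proj₂ (wf Q ρ₀ ρ₀∈))) _ _ m

    valid-uniqueTargets : ∀ {Q ρ} → ValidFor G RS Q ρ → UniqueTargets (posA ρ)
    valid-uniqueTargets {Q} (ρ₀ , τ , ρ₀∈ , _ , τ-inj , _ , refl) x a y x' a' y' m m' y≡y'
      with ∈-map⁻ _ m | ∈-map⁻ _ m'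
    ... | (_ , _ , y₀) , m₀ , refl | (_ , _ , y₀') , m₀' , refl
      with τ-inj y₀ y₀' (target∈targetvars ρ₀ m₀) (target∈targetvars ρ₀ m₀') y≡y'
    ... | refl with proj₁ (proj₂ (proj₂ (proj₂ (wf Q ρ₀ ρ₀∈)))) _ _ y₀ _ _ y₀ m₀ m₀' refl
    ...   | refl = refl

    valid-sound : ∀ {Q ρ} → ValidFor G RS Q ρ → Sound G ρ
    valid-sound {Q} (ρ₀ , τ , ρ₀∈ , τ-id , _ , _ , refl) θ (pos , neg) =
      ≡.subst₂ (λ s t → Trans G s (action ρ₀) t)
        (subst-cong (source ρ₀) (θ ∘ τ) θ
           (λ v m → cong θ (τ-id v (≡.subst (λ t → v ∈ vars t) (proj₁ wf₀) m))))
        (sym (subst-comp (target ρ₀) (var ∘ τ) θ))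
        (sound Q ρ₀ ρ₀∈ (θ ∘ τ) satτ)
      where
      wf₀ : WellFormedFor G Q ρ₀
      wf₀ = wf Q ρ₀ ρ₀∈
      -- the renaming fixes the antecedent sources, which are variables of Q
      satτ : SatAnte G (θ ∘ τ) ρ₀
      satτ = (λ x a y m → ≡.subst (λ z → Trans G (θ z) a (θ (τ y)))
                             (sym (τ-id x (proj₁ (proj₂ wf₀) x a y m))) (pos x a (τ y) (∈-map⁺ _ m)))
           , (λ x b m → ≡.subst (λ z → ¬ Σ (CTm G) (Trans G (θ z) b))
                             (sym (τ-id x (proj₁ (proj₂ (proj₂ wf₀)) x b m))) (neg x b m))

  module Matching (RS : RuloidSets G) (R : Tm G → Tm G → Set)
    {P Q : Tm G} {σ σ' : CSubst G} {ρ ρ' : Ruloid G}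
    (ρ∈ : ρ ∈ RuloidSets.ruloids RS P) (satρ : SatAnte G σ' ρ)
    (agree : ∀ v → v ∈ vars P → σ' v ≡ σ v)
    (valid : ValidFor G RS Q ρ') (matches : Matches G RS R ρ ρ') (enabled : Enabled σ ρ')
    where
    open RuloidSets RS
    open ValidRuloids RS
    open ChooseTargets (λ x b q → Trans G (σ x) b q)

    sourceρ : source ρ ≡ P
    sourceρ = proj₁ (wf P ρ ρ∈)

    targetVarsρ : ∀ z → z ∈ vars (target ρ) → z ∈ vars P ⊎ z ∈ targetvars G ρ
    targetVarsρ = proj₂ (proj₂ (proj₂ (proj₂ (proj₂ (wf P ρ ρ∈)))))

    disjoint : ∀ v → (v ∈ targetvars G ρ' ⊎ v ∈ targetvars G ρ) →
      (v ∈ sourcevars G ρ ⊎ v ∈ sourcevars G ρ') → ⊥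
    disjoint = proj₁ (proj₂ (proj₂ matches))

    shared : ∀ y → y ∈ targetvars G ρ → y ∈ targetvars G ρ' →
      Σ[ x ∈ ℕ ] Σ[ b ∈ Act ] (x ∈ sourcevars G ρ × x ∈ sourcevars G ρ' ×
        (x , b , y) ∈ posA ρ × (x , b , y) ∈ posA ρ')
    shared = proj₂ (proj₂ (proj₂ matches))

    θ : CSubst G
    θ = override (targetvars G ρ) σ' (choose (posA ρ') (proj₁ enabled) σ)

    -- variables of P or Q are targets of neither ruloid (condition (c))
    notTarget : ∀ {v} → (v ∈ sourcevars G ρ ⊎ v ∈ sourcevars G ρ') →
      v ∉ targetvars G ρ × (∀ x b → (x , b , v) ∉ posA ρ')
    notTarget v∈ = (λ t → disjoint _ (inj₂ t) v∈)
                 , (λ x b m → disjoint _ (inj₁ (target∈targetvars ρ' m)) v∈)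

    θ-outsideTargets : ∀ {v} → (v ∈ sourcevars G ρ ⊎ v ∈ sourcevars G ρ') → θ v ≡ σ v
    θ-outsideTargets v∈ =
      trans (override-out (targetvars G ρ) σ' _ (proj₁ (notTarget v∈)))
            (choose-absent (posA ρ') (proj₁ enabled) σ (proj₂ (notTarget v∈)))

    θ-onQ : ∀ {v} → v ∈ vars Q → θ v ≡ σ v
    θ-onQ v∈ = θ-outsideTargets (inj₂ (∈-sourcevars ρ' (valid-source valid) v∈))

    θ-onP : ∀ {v} → v ∈ vars P → θ v ≡ σ' v
    θ-onP v∈ = trans (θ-outsideTargets (inj₁ (∈-sourcevars ρ sourceρ v∈))) (sym (agree _ v∈))

    -- θ reproduces the target of ρ, whose variables come from P or are
    -- targets of ρ
    θ-onTargetρ : subst (target ρ) σ' ≡ subst (target ρ) θ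
    θ-onTargetρ = subst-cong (target ρ) σ' θ (λ v m → sym (θ-onTarget v (targetVarsρ v m)))
      where
      θ-onTarget : ∀ v → v ∈ vars P ⊎ v ∈ targetvars G ρ → θ v ≡ σ' v
      θ-onTarget v (inj₁ v∈P) = θ-onP v∈P
      θ-onTarget v (inj₂ v∈T) = override-in (targetvars G ρ) σ' _ v∈T

    -- A positive antecedent of ρ' whose target is shared with ρ is the
    -- very antecedent of ρ (condition (d) and unique targets), so σ'
    -- supplies the transition; otherwise the chosen witness does.
    θ-satisfies : SatAnte G θ ρ'
    θ-satisfies = positive , negative
      where
      positive : ∀ x b y → (x , b , y) ∈ posA ρ' → Trans G (θ x) b (θ y)
      positive x b y m rewrite θ-onQ (valid-posSource valid m) = byCase (y ∈? targetvars G ρ)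
        where
        byCase : Dec (y ∈ targetvars G ρ) → Trans G (σ x) b (θ y)
        byCase (yes y∈T) with shared y y∈T (target∈targetvars ρ' m)
        ... | x₀ , b₀ , x₀∈src , _ , mρ , mρ'
          with valid-uniqueTargets valid x b y x₀ b₀ y m mρ' refl
        ...   | refl = ≡.subst₂ (λ p q → Trans G p b q)
                         (agree x (≡.subst (λ t → x ∈ vars t) sourceρ x₀∈src))
                         (sym (override-in (targetvars G ρ) σ' _ y∈T))
                         (proj₁ satρ x b y mρ)
        byCase (no y∉T) = ≡.subst (Trans G (σ x) b)
          (sym (override-out (targetvars G ρ) σ' _ y∉T))
          (choose-witness (posA ρ') (proj₁ enabled) σ (valid-uniqueTargets valid) x b y m)
      negative : ∀ x b → (x , b) ∈ negA ρ' → ¬ Σ (CTm G) (Trans G (θ x) b)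
      negative x b m rewrite θ-onQ (valid-negSource valid m) = proj₂ enabled x b m

    matchedTransition : Trans G (subst Q σ) (action ρ) (subst (target ρ') θ)
    matchedTransition =
      ≡.subst₂ (λ s c → Trans G s c (subst (target ρ') θ))
        (trans (cong (λ t → subst t θ) (valid-source valid)) (subst-cong Q θ σ (λ v → θ-onQ)))
        (proj₁ matches)
        (valid-sound valid θ θ-satisfies)

  module Bisimulation (RS : RuloidSets G) (R : Tm G → Tm G → Set)
    (isRM : IsRuleMatchingBisim G RS R) where
    open RuloidSets RS

    Instances : CTm G → CTm G → Set
    Instances p q = Σ[ P ∈ Tm G ] Σ[ Q ∈ Tm G ] Σ[ σ ∈ CSubst G ]
      (R P Q × p ≡ subst P σ × q ≡ subst Q σ)

    transfer : ∀ {P Q} σ → R P Q → ∀ a p' → Trans G (subst P σ) a p' →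
      Σ[ q' ∈ CTm G ] (Trans G (subst Q σ) a q' × Instances p' q')
    transfer {P} {Q} σ RPQ a p' tr with find (supporting P a σ p' tr)
    ... | ρ , ρ∈ , refl , σ' , satρ , srcEq , refl with proj₂ isRM P Q RPQ ρ ρ∈
    ...   | J , allValid , allMatch , entails
      with find (entails σ
                  (sat⇒hyps ρ (wf P ρ ρ∈) (agreeOnSource ρ (proj₁ (wf P ρ ρ∈)) srcEq) satρ))
    ...     | ρ' , ρ'∈ , satρ' =
      subst (target ρ') θ , matchedTransition ,
      target ρ , target ρ' , θ , proj₁ (proj₂ (All-lookup allMatch ρ'∈)) , θ-onTargetρ , refl
      where
      open Matching RS R ρ∈ satρ (agreeOnSource ρ (proj₁ (wf P ρ ρ∈)) srcEq)
        (All-lookup allValid ρ'∈) (All-lookup allMatch ρ'∈) (sat⇒enabled σ ρ' satρ')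

    instances-bisimulation : IsBisimulation G Instances
    instances-bisimulation =
        (λ { (P , Q , σ , RPQ , p≡ , q≡) → Q , P , σ , proj₁ isRM RPQ , q≡ , p≡ })
      , λ { _ _ (P , Q , σ , RPQ , refl , refl) → transfer σ RPQ }

theorem5p1 : (nA : ℕ) (G : GSOS (Fin (suc nA))) → NoJunkRules G →
    (RS : RuloidSets G) → (P Q : Tm G) →
    RMBisimilar G RS P Q → ValidEq G P Q
theorem5p1 nA G _ RS P Q (R , isRM , RPQ) σ =
  Instances , instances-bisimulation , P , Q , σ , RPQ , refl , refl
  where open Soundness.Bisimulation G RS R isRM
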